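{- Let $G=(V,E)$ be a simple undirected graph and let $M, N \subseteq E$ be two triangle-free $2$-matchings of $G$. Then the edge set $M \oplus N = (M\setminus N)\cup(N\setminus M)$ can be partitioned into $M$-alternating paths and $M$-alternating cycles such that each of these paths and cycles is amenable with respect to $M$.
   Context: A $2$-matching of $G$ is a set $F\subseteq E$ such that every vertex is incident to at most two edges of $F$; it is triangle-free if it contains no cycle of length three (triangle). A path is a sequence of vertices $(v_0,\dots,v_l)$, $l\ge 1$, with $(v_i,v_{i+1})\in E$; paths and cycles are treated as edge sets or as sequences of edges. An $M$-alternating path is a vertex sequence $(v_1,\dots,v_k)$ whose consecutive edges are alternately in $M$ and not in $M$, and in which no edge occurs more than once (vertices may repeat, via different edges). An $M$-alternating cycle is defined in the same way except that $v_1=v_k$ and additionally $(v_{k-1},v_k)\in M$ iff $(v_1,v_2)\notin M$. An $M$-alternating path or cycle $P$ is amenable with respect to $M$ if for every triangle $t$ of $G$ all of whose edges lie in $M\cup P$, some two edges of $t$ are consecutive on $P$. -}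

module Defs where

open import Data.Nat using (ℕ)
open import Data.Fin using (Fin)
open import Data.Bool using (Bool; true; false; not; _xor_)
open import Data.Maybe using (Maybe; just)
open import Data.Product using (Σ; _×_; _,_; ∃)
open import Data.Sum using (_⊎_)
open import Data.List using (List; []; _∷_; _++_; take; head; last; concatMap)
open import Data.List.Relation.Unary.All using (All)
open import Data.List.Relation.Unary.Any using (Any)
open import Data.List.Relation.Unary.AllPairs using (AllPairs)
open import Data.List.Relation.Unary.Linked using (Linked)
open import Relation.Nullary using (¬_)
open import Relation.Binary.PropositionalEquality using (_≡_)

record Graph (n : ℕ) : Set where
  field
    adj    : Fin n → Fin n → Bool
    sym    : ∀ u v → adj u v ≡ adj v u
    irrefl : ∀ v → adj v v ≡ false
open Graph public

EdgeSet : ℕ → Set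
EdgeSet n = Fin n → Fin n → Bool

IsEdgeSetOf : ∀ {n} → Graph n → EdgeSet n → Set
IsEdgeSetOf G F = (∀ u v → F u v ≡ F v u) × (∀ u v → F u v ≡ true → adj G u v ≡ true)

IsTwoMatching : ∀ {n} → EdgeSet n → Set
IsTwoMatching {n} F = ∀ (v a b c : Fin n) → F v a ≡ true → F v b ≡ true → F v c ≡ true →
  a ≡ b ⊎ a ≡ c ⊎ b ≡ c

-- F contains no triangle (loops are excluded since F ⊆ E and G is simple)
TriangleFree : ∀ {n} → EdgeSet n → Set
TriangleFree {n} F = ∀ (a b c : Fin n) → ¬ (F a b ≡ true × F b c ≡ true × F c a ≡ true)

_⊕_ : ∀ {n} → EdgeSet n → EdgeSet n → EdgeSet n
(M ⊕ N) u v = M u v xor N u v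

-- an (oriented) vertex pair standing for an undirected edge
Edge : ℕ → Set
Edge n = Fin n × Fin n

SameEdge : ∀ {n} → Edge n → Edge n → Set
SameEdge (a , b) (c , d) = (a ≡ c × b ≡ d) ⊎ (a ≡ d × b ≡ c)

inSet : ∀ {n} → EdgeSet n → Edge n → Bool
inSet F (u , v) = F u v

edges : ∀ {n} → List (Fin n) → List (Edge n)
edges (a ∷ b ∷ rest) = (a , b) ∷ edges (b ∷ rest)
edges _ = []

Alt : ∀ {n} → EdgeSet n → Edge n → Edge n → Set
Alt M e f = inSet M e ≡ not (inSet M f)

AltWalk : ∀ {n} → Graph n → EdgeSet n → List (Fin n) → Set
AltWalk G M vs =
  Σ (Edge _) (λ e → Σ (List (Edge _)) (λ es → edges vs ≡ e ∷ es)) ×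
  All (λ e → inSet (adj G) e ≡ true) (edges vs) ×
  Linked (Alt M) (edges vs) ×
  AllPairs (λ e f → ¬ SameEdge e f) (edges vs)

AltPath : ∀ {n} → Graph n → EdgeSet n → List (Fin n) → Set
AltPath G M vs = AltWalk G M vs

AltCycle : ∀ {n} → Graph n → EdgeSet n → List (Fin n) → Set
AltCycle G M vs = AltWalk G M vs × head vs ≡ last vs ×
  (∀ e f → head (edges vs) ≡ just e → last (edges vs) ≡ just f → Alt M f e)

data Kind : Set where
  path cycle : Kind

IsAltKind : ∀ {n} → Graph n → EdgeSet n → Kind → List (Fin n) → Set
IsAltKind G M path  vs = AltPath G M vs
IsAltKind G M cycle vs = AltCycle G M vs

data Consec {A : Set} : List A → A → A → Set where
  here  : ∀ {x y xs} → Consec (x ∷ y ∷ xs) x y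
  there : ∀ {z x y xs} → Consec xs x y → Consec (z ∷ xs) x y

-- the sequence in which consecutiveness is read: for a cycle the last and
-- the first edge are also consecutive
consecSeq : ∀ {n} → Kind → List (Fin n) → List (Edge n)
consecSeq path  vs = edges vs
consecSeq cycle vs = edges vs ++ take 1 (edges vs)

ConsecutiveOn : ∀ {n} → Kind → List (Fin n) → Edge n → Edge n → Set
ConsecutiveOn k vs e f = ∃ λ x → ∃ λ y → Consec (consecSeq k vs) x y ×
  ((SameEdge x e × SameEdge y f) ⊎ (SameEdge x f × SameEdge y e))

InMOrP : ∀ {n} → EdgeSet n → List (Fin n) → Edge n → Set
InMOrP M vs e = inSet M e ≡ true ⊎ Any (SameEdge e) (edges vs)

Amenable : ∀ {n} → Graph n → EdgeSet n → Kind → List (Fin n) → Set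
Amenable {n} G M k vs = ∀ (a b c : Fin n) →
  adj G a b ≡ true → adj G b c ≡ true → adj G c a ≡ true →
  InMOrP M vs (a , b) → InMOrP M vs (b , c) → InMOrP M vs (c , a) →
  ConsecutiveOn k vs (a , b) (b , c) ⊎ ConsecutiveOn k vs (b , c) (c , a) ⊎
  ConsecutiveOn k vs (c , a) (a , b)

Piece : ℕ → Set
Piece n = Kind × List (Fin n)

pieceEdges : ∀ {n} → Piece n → List (Edge n)
pieceEdges (_ , vs) = edges vs

GoodPiece : ∀ {n} → Graph n → EdgeSet n → Piece n → Set
GoodPiece G M (k , vs) = IsAltKind G M k vs × Amenable G M k vs

IsAmenableDecomposition : ∀ {n} → Graph n → EdgeSet n → EdgeSet n → List (Piece n) → Set
IsAmenableDecomposition {n} G M N ps =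
  All (GoodPiece G M) ps ×
  All (λ e → inSet (M ⊕ N) e ≡ true) (concatMap pieceEdges ps) ×
  AllPairs (λ e f → ¬ SameEdge e f) (concatMap pieceEdges ps) ×
  (∀ (u v : Fin n) → (M ⊕ N) u v ≡ true → Any (SameEdge (u , v)) (concatMap pieceEdges ps))

-- Pair edges of M ⊕ N at corners of triangles: whenever a triangle v p r has vr ∈ N∖M, vp ∈ M∖N
-- and pr ∈ M, it may be served at v by pairing vr with vp.  Every triangle with an N∖M edge and
-- its other two edges in M has such a candidate corner (N is triangle-free), and the corners are
-- selected so that each triangle is served exactly once and each edge is paired with at most one
-- other edge at each of its ends.  Since M is a 2-matching, a walk along three successive
-- pairings returns to its start with a fourth, so the components of the pairing are
-- M-alternating paths with at most three edges and alternating 4-cycles, all without repeated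
-- vertices.  A triangle of G inside M ∪ P with two edges on such a piece P has them meeting in a
-- vertex, hence consecutive on P; one with a single edge on P has that edge in N∖M (M is
-- triangle-free), and the corner serving it puts a second edge of it next to it on P.  Listing
-- each component once, from its least edge, gives the decomposition.

module Submission where

open import Defs hiding (sym)
open import Data.Bool using (Bool; true; false; not; _xor_; _∧_; _∨_; if_then_else_)
open import Data.Bool.Properties using (∨-comm; not-involutive; not-distribʳ-xor) renaming (_≟_ to _≟ᵇ_)
open import Data.Empty using (⊥; ⊥-elim)
open import Data.Fin using (Fin; zero; suc; _<_; _≟_; _<?_)
open import Data.Fin.Properties using (<-cmp; <-irrefl; <-asym; ≤-decTotalOrder)
open import Data.List using (List; []; _∷_; _++_; map; concatMap; filter; allFin; cartesianProduct)
open import Data.List.Relation.Unary.All as All using (All; []; _∷_)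
import Data.List.Relation.Unary.All.Properties as All
open import Data.List.Relation.Unary.Any as Any using (Any; here; there)
import Data.List.Relation.Unary.Any.Properties as Any
open import Data.List.Relation.Unary.AllPairs using (AllPairs; []; _∷_)
import Data.List.Relation.Unary.AllPairs.Properties as AllPairs
open import Data.List.Relation.Unary.Linked using (Linked; [-]; _∷_)
open import Data.List.Membership.Propositional using (_∈_)
open import Data.List.Membership.Propositional.Properties using (∈-allFin; ∈-cartesianProduct⁺; ∈-filter⁺; ∈-filter⁻)
open import Data.List.Relation.Unary.Unique.Propositional using (Unique)
open import Data.List.Relation.Unary.Unique.Propositional.Properties using (allFin⁺; cartesianProduct⁺)
open import Data.Maybe using (Maybe; just; nothing)
open import Data.Maybe.Properties using (just-injective)
open import Data.Nat using (ℕ)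
open import Data.Product using (Σ; _×_; _,_; ∃; proj₁; proj₂)
open import Data.Product.Relation.Binary.Lex.NonStrict using (×-decTotalOrder)
open import Data.Product.Relation.Binary.Pointwise.NonDependent using (≡×≡⇒≡)
open import Data.Sum using (_⊎_; inj₁; inj₂; [_,_]′)
open import Relation.Binary using (tri<; tri≈; tri>; DecTotalOrder)
open import Relation.Binary.Construct.Closure.ReflexiveTransitive using (Star; ε; _◅_; _◅◅_; reverse)
open import Relation.Binary.PropositionalEquality using (_≡_; _≢_; ≢-sym; refl; sym; trans; cong; subst)
open import Relation.Nullary using (¬_; yes; no; does; Dec; _×-dec_)
open import Relation.Nullary.Decidable using (dec-true; dec-false)

true≢false : true ≢ false
true≢false ()

just-nothing-clash : ∀ {A : Set} {m : Maybe A} {x} → m ≡ just x → m ≡ nothing → ⊥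
just-nothing-clash refl ()

true-or-false : ∀ b → b ≡ true ⊎ b ≡ false
true-or-false true  = inj₁ refl
true-or-false false = inj₂ refl

first : ∀ {n} → (Fin n → Bool) → Maybe (Fin n)
first {ℕ.zero}  p = nothing
first {ℕ.suc n} p with p zero
... | true  = just zero
... | false with first (λ i → p (suc i))
...   | just i  = just (suc i)
...   | nothing = nothing

first-sound : ∀ {n} (p : Fin n → Bool) {w} → first p ≡ just w → p w ≡ true
first-sound {ℕ.suc n} p eq with p zero in p0
first-sound {ℕ.suc n} p refl | true = p0
... | false with first (λ i → p (suc i)) in rest
first-sound {ℕ.suc n} p refl | false | just i = first-sound (λ i → p (suc i)) rest

first-nothing : ∀ {n} (p : Fin n → Bool) → first p ≡ nothing → ∀ w → p w ≡ false
first-nothing {ℕ.suc n} p eq w with p zero in p0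
first-nothing {ℕ.suc n} p () w | true
... | false with first (λ i → p (suc i)) in rest
first-nothing {ℕ.suc n} p eq zero    | false | nothing = p0
first-nothing {ℕ.suc n} p eq (suc w) | false | nothing = first-nothing (λ i → p (suc i)) rest w

first-complete : ∀ {n} (p : Fin n → Bool) {w} → p w ≡ true → ∃ λ q → first p ≡ just q
first-complete p {w} pw with first p in eq
... | just q  = q , refl
... | nothing = ⊥-elim (true≢false (trans (sym pw) (first-nothing p eq w)))

first-cong : ∀ {n} (p q : Fin n → Bool) → (∀ i → p i ≡ q i) → first p ≡ first q
first-cong {ℕ.zero}  p q p≗q = refl
first-cong {ℕ.suc n} p q p≗q with p zero in p0 | q zero in q0
... | true  | true  = refl
... | true  | false = ⊥-elim (true≢false (trans (sym p0) (trans (p≗q zero) q0)))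
... | false | true  = ⊥-elim (true≢false (trans (sym q0) (trans (sym (p≗q zero)) p0)))
... | false | false rewrite first-cong (λ i → p (suc i)) (λ i → q (suc i)) (λ i → p≗q (suc i)) = refl

∨-true : ∀ {a b} → a ∨ b ≡ true → a ≡ true ⊎ b ≡ true
∨-true {true}  _ = inj₁ refl
∨-true {false} b = inj₂ b

∨-introˡ : ∀ {a b} → a ≡ true → a ∨ b ≡ true
∨-introˡ refl = refl

∨-introʳ : ∀ {a b} → b ≡ true → a ∨ b ≡ true
∨-introʳ {true}  _ = refl
∨-introʳ {false} b = b

≡not-true⇒false : ∀ {a b} → a ≡ not b → a ≡ true → b ≡ false
≡not-true⇒false {b = true}  a≡¬b refl = ⊥-elim (true≢false a≡¬b)
≡not-true⇒false {b = false} _ _ = refl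

≡not-false⇒true : ∀ {a b} → a ≡ not b → a ≡ false → b ≡ true
≡not-false⇒true {b = true}  _ _ = refl
≡not-false⇒true {b = false} a≡¬b refl = ⊥-elim (true≢false (sym a≡¬b))

xor-complement-conflict : ∀ x z → not (x xor z) ≡ true → not (not x xor z) ≡ true → ⊥
xor-complement-conflict true  true  _ ()
xor-complement-conflict true  false () _
xor-complement-conflict false true  () _
xor-complement-conflict false false _ ()

_<ᵇ_ : ∀ {n} → Fin n → Fin n → Bool
i <ᵇ j = does (i <? j)

<ᵇ-flip : ∀ {n} {i j : Fin n} → i ≢ j → i <ᵇ j ≡ not (j <ᵇ i)
<ᵇ-flip {i = i} {j} i≢j with <-cmp i j
... | tri< i<j _ j≮i = trans (dec-true (i <? j) i<j) (cong not (sym (dec-false (j <? i) j≮i)))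
... | tri≈ _ i≡j _   = ⊥-elim (i≢j i≡j)
... | tri> i≮j _ j<i = trans (dec-false (i <? j) i≮j) (cong not (sym (dec-true (j <? i) j<i)))

AllPairs-combine : ∀ {A : Set} {P : A → Set} {R S : A → A → Set} →
  (∀ {x y} → P x → P y → R x y → S x y) → ∀ {xs} → All P xs → AllPairs R xs → AllPairs S xs
AllPairs-combine f []         []         = []
AllPairs-combine f (px ∷ pxs) (rx ∷ rxs) =
  All.zipWith (λ (py , r) → f px py r) (pxs , rx) ∷ AllPairs-combine f pxs rxs

-- Undirected edges and vertex sequences

module _ {n : ℕ} where

  SameEdge-refl : ∀ {e : Edge n} → SameEdge e e
  SameEdge-refl = inj₁ (refl , refl)

  SameEdge-swap : ∀ {a b : Fin n} → SameEdge (a , b) (b , a)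
  SameEdge-swap = inj₂ (refl , refl)

  SameEdge-sym : ∀ {e f : Edge n} → SameEdge e f → SameEdge f e
  SameEdge-sym (inj₁ (refl , refl)) = inj₁ (refl , refl)
  SameEdge-sym (inj₂ (refl , refl)) = inj₂ (refl , refl)

  SameEdge-trans : ∀ {e f g : Edge n} → SameEdge e f → SameEdge f g → SameEdge e g
  SameEdge-trans (inj₁ (refl , refl)) s = s
  SameEdge-trans (inj₂ (refl , refl)) (inj₁ (refl , refl)) = inj₂ (refl , refl)
  SameEdge-trans (inj₂ (refl , refl)) (inj₂ (refl , refl)) = inj₁ (refl , refl)

  infix 4 _∈ᴱ_

  _∈ᴱ_ : Edge n → List (Fin n) → Set
  e ∈ᴱ vs = Any (SameEdge e) (edges vs)

  ∈⇒∈ᴱ : ∀ {e vs} → e ∈ edges vs → e ∈ᴱ vs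
  ∈⇒∈ᴱ = Any.map (λ { refl → SameEdge-refl })

  ∈ᴱ-resp : ∀ {e f vs} → SameEdge e f → f ∈ᴱ vs → e ∈ᴱ vs
  ∈ᴱ-resp s = Any.map (SameEdge-trans s)

  ∈ᴱ-swap : ∀ {a b vs} → (a , b) ∈ᴱ vs → (b , a) ∈ᴱ vs
  ∈ᴱ-swap = ∈ᴱ-resp SameEdge-swap

  All-∈ᴱ : ∀ {P : Edge n → Set} {e vs} → (∀ {f g} → SameEdge f g → P g → P f) →
    All P (edges vs) → e ∈ᴱ vs → P e
  All-∈ᴱ {P} {e} resp ps e∈ = All.lookupWith {R = λ _ → P e} (λ pg s → resp s pg) ps e∈

  normal : Edge n → Edge n
  normal (p , q) with <-cmp p q
  ... | tri> _ _ _ = q , p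
  ... | _          = p , q

  normal-SameEdge : ∀ e → SameEdge e (normal e)
  normal-SameEdge (p , q) with <-cmp p q
  ... | tri< _ _ _ = SameEdge-refl
  ... | tri≈ _ _ _ = SameEdge-refl
  ... | tri> _ _ _ = SameEdge-swap

  normal-of-< : ∀ {p q} → p < q → normal (p , q) ≡ (p , q)
  normal-of-< {p} {q} p<q with <-cmp p q
  ... | tri< _ _ _   = refl
  ... | tri≈ _ _ _   = refl
  ... | tri> _ _ q<p = ⊥-elim (<-asym p<q q<p)

  normal-< : ∀ p q → p ≢ q → proj₁ (normal (p , q)) < proj₂ (normal (p , q))
  normal-< p q p≢q with <-cmp p q
  ... | tri< p<q _ _ = p<q
  ... | tri≈ _ p≡q _ = ⊥-elim (p≢q p≡q)
  ... | tri> _ _ q<p = q<p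

  normal-swap : ∀ p q → normal (q , p) ≡ normal (p , q)
  normal-swap p q with <-cmp p q | <-cmp q p
  ... | tri< _ _ _     | tri> _ _ _     = refl
  ... | tri> _ _ _     | tri< _ _ _     = refl
  ... | tri≈ _ refl _  | tri≈ _ _ _     = refl
  ... | tri≈ _ refl _  | tri< p<p _ _   = ⊥-elim (<-irrefl refl p<p)
  ... | tri≈ _ refl _  | tri> _ _ p<p   = ⊥-elim (<-irrefl refl p<p)
  ... | tri< p<q _ _   | tri< q<p _ _   = ⊥-elim (<-asym p<q q<p)
  ... | tri< _ p≢q _   | tri≈ _ q≡p _   = ⊥-elim (p≢q (sym q≡p))
  ... | tri> _ _ q<p   | tri> _ _ p<q   = ⊥-elim (<-asym p<q q<p)
  ... | tri> _ p≢q _   | tri≈ _ q≡p _   = ⊥-elim (p≢q (sym q≡p))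

  normal-resp : ∀ {e f : Edge n} → SameEdge e f → normal e ≡ normal f
  normal-resp (inj₁ (refl , refl)) = refl
  normal-resp {p , q} (inj₂ (refl , refl)) = sym (normal-swap p q)

  edgeOrder : DecTotalOrder _ _ _
  edgeOrder = ×-decTotalOrder (≤-decTotalOrder n) (≤-decTotalOrder n)

  open DecTotalOrder edgeOrder public
    using () renaming (_≤_ to _≤ᴱ_; _≤?_ to _≤ᴱ?_; antisym to ≤ᴱ-antisym)

  ∈ᴱ⇒∈ : ∀ {a z : Fin n} ws → (a , z) ∈ᴱ ws → a ∈ ws
  ∈ᴱ⇒∈ (p ∷ q ∷ r) (here (inj₁ (a≡p , _))) = here a≡p
  ∈ᴱ⇒∈ (p ∷ q ∷ r) (here (inj₂ (a≡q , _))) = there (here a≡q)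
  ∈ᴱ⇒∈ (p ∷ q ∷ r) (there e∈) = there (∈ᴱ⇒∈ (q ∷ r) e∈)

  Consec-++ : ∀ {A : Set} {xs ys : List A} {p q} → Consec xs p q → Consec (xs ++ ys) p q
  Consec-++ here        = here
  Consec-++ (there p-q) = there (Consec-++ p-q)

  AdjacentEdgesConsecutive : Kind → List (Fin n) → Set
  AdjacentEdgesConsecutive k vs = ∀ {x y z} → x ≢ z → (x , y) ∈ᴱ vs → (y , z) ∈ᴱ vs →
    ConsecutiveOn k vs (x , y) (y , z)

  unique-first-edge : ∀ {b z rest} → Unique (b ∷ rest) → (b , z) ∈ᴱ (b ∷ rest) → ∃ λ r → rest ≡ z ∷ r
  unique-first-edge {rest = c ∷ r} _ (here (inj₁ (refl , refl))) = r , refl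
  unique-first-edge {rest = c ∷ r} ((b≢c ∷ _) ∷ _) (here (inj₂ (b≡c , _))) = ⊥-elim (b≢c b≡c)
  unique-first-edge {rest = c ∷ r} (b∉ ∷ _) (there e∈) = ⊥-elim (All.All¬⇒¬Any b∉ (∈ᴱ⇒∈ (c ∷ r) e∈))

  consecutive-on-path : ∀ (vs : List (Fin n)) → Unique vs → AdjacentEdgesConsecutive path vs
  consecutive-on-path (a ∷ b ∷ _) ((a≢b ∷ _) ∷ _) _ (here (inj₁ (refl , refl))) (here (inj₁ (refl , refl))) = ⊥-elim (a≢b refl)
  consecutive-on-path (a ∷ b ∷ _) _ x≢z (here (inj₁ (refl , refl))) (here (inj₂ (refl , refl))) = ⊥-elim (x≢z refl)
  consecutive-on-path (a ∷ b ∷ _) _ x≢z (here (inj₂ (refl , refl))) (here (inj₁ (refl , refl))) = ⊥-elim (x≢z refl)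
  consecutive-on-path (a ∷ b ∷ _) ((a≢b ∷ _) ∷ _) _ (here (inj₂ (refl , refl))) (here (inj₂ (refl , refl))) = ⊥-elim (a≢b refl)
  consecutive-on-path (a ∷ b ∷ rest) (_ ∷ u) _ (here (inj₁ (refl , refl))) (there yz∈) with unique-first-edge u yz∈
  ... | _ , refl = _ , _ , here , inj₁ (SameEdge-refl , SameEdge-refl)
  consecutive-on-path (a ∷ b ∷ rest) (a∉ ∷ _) _ (here (inj₂ (refl , refl))) (there yz∈) =
    ⊥-elim (All.All¬⇒¬Any a∉ (∈ᴱ⇒∈ (b ∷ rest) yz∈))
  consecutive-on-path (a ∷ b ∷ rest) (a∉ ∷ _) _ (there xy∈) (here (inj₁ (refl , refl))) =
    ⊥-elim (All.All¬⇒¬Any a∉ (∈ᴱ⇒∈ (b ∷ rest) (∈ᴱ-swap xy∈)))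
  consecutive-on-path (a ∷ b ∷ rest) (_ ∷ u) _ (there xy∈) (here (inj₂ (refl , refl))) with unique-first-edge u (∈ᴱ-swap xy∈)
  ... | _ , refl = _ , _ , here , inj₂ (SameEdge-swap , SameEdge-swap)
  consecutive-on-path (a ∷ b ∷ rest) (_ ∷ u) x≢z (there xy∈) (there yz∈) with consecutive-on-path (b ∷ rest) u x≢z xy∈ yz∈
  ... | e , f , e-f , same = e , f , there e-f , same

  edges-unique : ∀ (vs : List (Fin n)) → Unique vs → AllPairs (λ e f → ¬ SameEdge e f) (edges vs)
  edges-unique []      _ = []
  edges-unique (a ∷ []) _ = []
  edges-unique (a ∷ b ∷ rest) (a∉ ∷ u) = later b (b ∷ rest) a∉ ∷ edges-unique (b ∷ rest) u
    where
    later : ∀ b ws → All (a ≢_) ws → All (λ f → ¬ SameEdge (a , b) f) (edges ws)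
    later b (p ∷ q ∷ r) (a≢p ∷ a≢q ∷ a∉) =
      [ (λ (a≡p , _) → a≢p a≡p) , (λ (a≡q , _) → a≢q a≡q) ]′ ∷ later b (q ∷ r) (a≢q ∷ a∉)
    later b (_ ∷ []) _ = []
    later b [] _ = []

  Unique-rotate₄ : ∀ {a b c d : Fin n} → Unique (a ∷ b ∷ c ∷ d ∷ []) → Unique (b ∷ c ∷ d ∷ a ∷ [])
  Unique-rotate₄ ((a≢b ∷ a≢c ∷ a≢d ∷ []) ∷ (b≢c ∷ b≢d ∷ []) ∷ (c≢d ∷ []) ∷ [] ∷ []) =
    (b≢c ∷ b≢d ∷ ≢-sym a≢b ∷ []) ∷ (c≢d ∷ ≢-sym a≢c ∷ []) ∷ (≢-sym a≢d ∷ []) ∷ [] ∷ []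

  4-cycle-edges-unique : ∀ {a b c d : Fin n} → Unique (a ∷ b ∷ c ∷ d ∷ []) →
    AllPairs (λ e f → ¬ SameEdge e f) (edges (a ∷ b ∷ c ∷ d ∷ a ∷ []))
  4-cycle-edges-unique u@((a≢b ∷ a≢c ∷ a≢d ∷ []) ∷ (_ ∷ b≢d ∷ []) ∷ _) =
    ( [ (λ (a≡b , _) → a≢b a≡b) , (λ (a≡c , _) → a≢c a≡c) ]′
    ∷ [ (λ (a≡c , _) → a≢c a≡c) , (λ (a≡d , _) → a≢d a≡d) ]′
    ∷ [ (λ (a≡d , _) → a≢d a≡d) , (λ (_ , b≡d) → b≢d b≡d) ]′ ∷ [])
    ∷ edges-unique _ (Unique-rotate₄ u)

  consecutive-on-4-cycle : ∀ {a b c d : Fin n} → Unique (a ∷ b ∷ c ∷ d ∷ []) →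
    AdjacentEdgesConsecutive cycle (a ∷ b ∷ c ∷ d ∷ a ∷ [])
  consecutive-on-4-cycle {a} {b} {c} {d} u@((a≢b ∷ _ ∷ a≢d ∷ []) ∷ (_ ∷ b≢d ∷ []) ∷ _) {x} {y} {z} x≢z = go
    where
    front : (x , y) ∈ᴱ (a ∷ b ∷ c ∷ d ∷ []) → (y , z) ∈ᴱ (a ∷ b ∷ c ∷ d ∷ []) →
      ConsecutiveOn cycle (a ∷ b ∷ c ∷ d ∷ a ∷ []) (x , y) (y , z)
    front xy∈ yz∈ with consecutive-on-path _ u x≢z xy∈ yz∈
    ... | e , f , e-f , same = e , f , Consec-++ e-f , same
    back : (x , y) ∈ᴱ (b ∷ c ∷ d ∷ a ∷ []) → (y , z) ∈ᴱ (b ∷ c ∷ d ∷ a ∷ []) →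
      ConsecutiveOn cycle (a ∷ b ∷ c ∷ d ∷ a ∷ []) (x , y) (y , z)
    back xy∈ yz∈ with consecutive-on-path _ (Unique-rotate₄ u) x≢z xy∈ yz∈
    ... | e , f , e-f , same = e , f , there (Consec-++ e-f) , same
    wrap : ConsecutiveOn cycle (a ∷ b ∷ c ∷ d ∷ a ∷ []) (d , a) (a , b)
    wrap = (d , a) , (a , b) , there (there (there here)) , inj₁ (SameEdge-refl , SameEdge-refl)
    go : (x , y) ∈ᴱ (a ∷ b ∷ c ∷ d ∷ a ∷ []) → (y , z) ∈ᴱ (a ∷ b ∷ c ∷ d ∷ a ∷ []) →
      ConsecutiveOn cycle (a ∷ b ∷ c ∷ d ∷ a ∷ []) (x , y) (y , z)
    go (there xy∈) (there yz∈) = back xy∈ yz∈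
    go (here s) (here t) = front (here s) (here t)
    go (here s) (there (here t)) = front (here s) (there (here t))
    go (here s) (there (there (here t))) = front (here s) (there (there (here t)))
    go (there (here s)) (here t) = front (there (here s)) (here t)
    go (there (there (here s))) (here t) = front (there (there (here s))) (here t)
    go (here (inj₁ (refl , refl))) (there (there (there (here (inj₁ (refl , refl)))))) = ⊥-elim (b≢d refl)
    go (here (inj₁ (refl , refl))) (there (there (there (here (inj₂ (refl , refl)))))) = ⊥-elim (a≢b refl)
    go (here (inj₂ (refl , refl))) (there (there (there (here (inj₁ (refl , refl)))))) = ⊥-elim (a≢d refl)
    go (here (inj₂ (refl , refl))) (there (there (there (here (inj₂ (refl , refl)))))) =
      (d , a) , (a , b) , there (there (there here)) , inj₂ (SameEdge-swap , SameEdge-swap)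
    go (there (there (there (here (inj₁ (refl , refl)))))) (here (inj₁ (refl , refl))) = wrap
    go (there (there (there (here (inj₁ (refl , refl)))))) (here (inj₂ (refl , refl))) = ⊥-elim (a≢b refl)
    go (there (there (there (here (inj₂ (refl , refl)))))) (here (inj₁ (refl , refl))) = ⊥-elim (a≢d refl)
    go (there (there (there (here (inj₂ (refl , refl)))))) (here (inj₂ (refl , refl))) = ⊥-elim (b≢d refl)

module _ {n : ℕ} (G : Graph n) where

  adj⇒≢ : ∀ {u v} → adj G u v ≡ true → u ≢ v
  adj⇒≢ {v = v} uv refl = true≢false (trans (sym uv) (irrefl G v))

  edge⇒≢ : ∀ {F u v} → IsEdgeSetOf G F → F u v ≡ true → u ≢ v
  edge⇒≢ {u = u} {v} (_ , F⊆G) uv = adj⇒≢ (F⊆G u v uv)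

  edge-swap : ∀ {F u v b} → IsEdgeSetOf G F → F u v ≡ b → F v u ≡ b
  edge-swap {u = u} {v} (F-sym , _) uv = trans (F-sym v u) uv

two-matching-third : ∀ {n} {F : EdgeSet n} {v a b c} → IsTwoMatching F →
  F v a ≡ true → F v b ≡ true → F v c ≡ true → a ≢ b → a ≢ c → b ≡ c
two-matching-third two va vb vc a≢b a≢c with two _ _ _ _ va vb vc
... | inj₁ a≡b        = ⊥-elim (a≢b a≡b)
... | inj₂ (inj₁ a≡c) = ⊥-elim (a≢c a≡c)
... | inj₂ (inj₂ b≡c) = b≡c

module Decomposition {n : ℕ} (G : Graph n) (M N : EdgeSet n)
  (M⊆G : IsEdgeSetOf G M) (N⊆G : IsEdgeSetOf G N)
  (M-two : IsTwoMatching M) (N-two : IsTwoMatching N)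
  (M-tf : TriangleFree M) (N-tf : TriangleFree N) where

  V : Set
  V = Fin n

  M⇒≢ : ∀ {u v} → M u v ≡ true → u ≢ v
  M⇒≢ = edge⇒≢ G M⊆G

  N⇒≢ : ∀ {u v} → N u v ≡ true → u ≢ v
  N⇒≢ = edge⇒≢ G N⊆G

  M-swap : ∀ {u v b} → M u v ≡ b → M v u ≡ b
  M-swap = edge-swap G M⊆G

  N-swap : ∀ {u v b} → N u v ≡ b → N v u ≡ b
  N-swap = edge-swap G N⊆G

  M-third : ∀ {v a b c} → M v a ≡ true → M v b ≡ true → M v c ≡ true → a ≢ b → a ≢ c → b ≡ c
  M-third = two-matching-third M-two

  N-third : ∀ {v a b c} → N v a ≡ true → N v b ≡ true → N v c ≡ true → a ≢ b → a ≢ c → b ≡ c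
  N-third = two-matching-third N-two

  M∖N N∖M M∩N : V → V → Bool
  M∖N u v = M u v ∧ not (N u v)
  N∖M u v = N u v ∧ not (M u v)
  M∩N u v = M u v ∧ N u v

  M∖N⇒M : ∀ {u v} → M∖N u v ≡ true → M u v ≡ true
  M∖N⇒M {u} {v} _ with M u v | N u v
  ... | true | false = refl

  M∖N⇒¬N : ∀ {u v} → M∖N u v ≡ true → N u v ≡ false
  M∖N⇒¬N {u} {v} _ with M u v | N u v
  ... | true | false = refl

  N∖M⇒N : ∀ {u v} → N∖M u v ≡ true → N u v ≡ true
  N∖M⇒N {u} {v} _ with M u v | N u v
  ... | false | true = refl

  N∖M⇒¬M : ∀ {u v} → N∖M u v ≡ true → M u v ≡ false
  N∖M⇒¬M {u} {v} _ with M u v | N u v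
  ... | false | true = refl

  M∩N⇒N : ∀ {u v} → M∩N u v ≡ true → N u v ≡ true
  M∩N⇒N {u} {v} _ with M u v | N u v
  ... | true | true = refl

  M∖N⇒¬M∩N : ∀ {u v} → M∖N u v ≡ true → M∩N u v ≡ false
  M∖N⇒¬M∩N {u} {v} _ with M u v | N u v
  ... | true | false = refl

  M∖N-intro : ∀ {u v} → M u v ≡ true → N u v ≡ false → M∖N u v ≡ true
  M∖N-intro m ¬n rewrite m | ¬n = refl

  N∖M-intro : ∀ {u v} → N u v ≡ true → M u v ≡ false → N∖M u v ≡ true
  N∖M-intro n ¬m rewrite n | ¬m = refl

  M∩N-intro : ∀ {u v} → M u v ≡ true → N u v ≡ true → M∩N u v ≡ true
  M∩N-intro m n rewrite m | n = refl


  M-clash : ∀ {u v} → M u v ≡ true → M v u ≡ false → ⊥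
  M-clash uv ¬vu = true≢false (trans (sym uv) (M-swap ¬vu))

  M∖N-N∖M-disjoint : ∀ {u v} → M∖N u v ≡ true → N∖M u v ≡ true → ⊥
  M∖N-N∖M-disjoint uv uv′ = true≢false (trans (sym (M∖N⇒M uv)) (N∖M⇒¬M uv′))

  ⊕-intro : ∀ {u v} → M∖N u v ≡ true ⊎ N∖M u v ≡ true → (M ⊕ N) u v ≡ true
  ⊕-intro (inj₁ uv) rewrite M∖N⇒M uv | M∖N⇒¬N uv = refl
  ⊕-intro (inj₂ uv) rewrite N∖M⇒¬M uv | N∖M⇒N uv = refl

  ⊕-M⇒¬N : ∀ {u v} → (M ⊕ N) u v ≡ true → M u v ≡ true → N u v ≡ false
  ⊕-M⇒¬N {u} {v} _ _ with M u v | N u v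
  ... | true | false = refl

  ⊕-¬M⇒N : ∀ {u v} → (M ⊕ N) u v ≡ true → M u v ≡ false → N u v ≡ true
  ⊕-¬M⇒N {u} {v} _ _ with M u v | N u v
  ... | false | true = refl

  ⊕-swap : ∀ {u v} → (M ⊕ N) u v ≡ true → (M ⊕ N) v u ≡ true
  ⊕-swap {u} {v} uv rewrite proj₁ M⊆G v u | proj₁ N⊆G v u = uv

  ⊕⇒adj : ∀ {u v} → (M ⊕ N) u v ≡ true → adj G u v ≡ true
  ⊕⇒adj {u} {v} uv with true-or-false (M u v)
  ... | inj₁ m  = proj₂ M⊆G u v m
  ... | inj₂ ¬m = proj₂ N⊆G u v (⊕-¬M⇒N uv ¬m)

  ⊕⇒≢ : ∀ {u v} → (M ⊕ N) u v ≡ true → u ≢ v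
  ⊕⇒≢ uv = adj⇒≢ G (⊕⇒adj uv)

  -- Selecting corners

  isSecondApex : V → V → V → V → Bool
  isSecondApex v r p q = M v q ∧ M r q ∧ not (does (q ≟ p))

  secondApex : V → V → V → Maybe V
  secondApex v r p = first (isSecondApex v r p)

  isSecondApex-sound : ∀ {v r p q} → isSecondApex v r p q ≡ true → M v q ≡ true × M r q ≡ true × q ≢ p
  isSecondApex-sound {v} {r} {p} {q} _ with M v q | M r q | q ≟ p
  ... | true | true | no q≢p = refl , refl , q≢p

  isSecondApex-intro : ∀ {v r p q} → M v q ≡ true → M r q ≡ true → q ≢ p → isSecondApex v r p q ≡ true
  isSecondApex-intro {p = p} {q} vq rq q≢p with q ≟ p
  ... | yes q≡p = ⊥-elim (q≢p q≡p)
  ... | no _ rewrite vq | rq = refl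

  secondApex-sym : ∀ v r p → secondApex v r p ≡ secondApex r v p
  secondApex-sym v r p = first-cong _ _ λ q → swap-∧ (M v q) (M r q)
    where
    swap-∧ : ∀ x y {z} → x ∧ y ∧ z ≡ y ∧ x ∧ z
    swap-∧ true  true  = refl
    swap-∧ true  false = refl
    swap-∧ false true  = refl
    swap-∧ false false = refl

  secondApex-unique : ∀ {v r p q} → M v p ≡ true → M v q ≡ true → M r q ≡ true → p ≢ q →
    secondApex v r p ≡ just q
  secondApex-unique {v} {r} {p} vp vq rq p≢q
    with first-complete (isSecondApex v r p) (isSecondApex-intro vq rq (≢-sym p≢q))
  ... | q′ , found with isSecondApex-sound (first-sound (isSecondApex v r p) found)
  ...   | vq′ , _ , q′≢p with M-third vp vq vq′ p≢q (≢-sym q′≢p)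
  ...     | refl = found

  -- A triangle v p r with vr ∈ N∖M and vp, pr ∈ M∖N can be served at v or at r, and tieBreak
  -- picks exactly one end.  If v and r have a second common M-neighbour q, the triangles v p r and
  -- v q r must be served at different ends of vr, since each end pairs vr with only one edge;
  -- comparing p < q with v < r arranges this.
  tieBreak : V → V → V → Maybe V → Bool
  tieBreak v r p nothing  = v <ᵇ r
  tieBreak v r p (just q) = if M∩N v q then true else (if M∩N r q then false else not (p <ᵇ q xor v <ᵇ r))

  selected : V → V → V → Bool
  selected v r p = M∩N r p ∨ tieBreak v r p (secondApex v r p)

  -- corner v p r: the triangle v p r is served at v, pairing vp ∈ M∖N with vr ∈ N∖M.
  corner : V → V → V → Bool
  corner v p r = M∖N v p ∧ N∖M v r ∧ M p r ∧ selected v r p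

  paired : V → V → V → Bool
  paired v u w = corner v u w ∨ corner v w u

  -- partner v u ≡ just w: at v, the edge vu is paired with vw.
  partner : V → V → Maybe V
  partner v u = first (paired v u)

  record Corner (v p r : V) : Set where
    field
      spoke   : M∖N v p ≡ true
      base    : N∖M v r ≡ true
      closing : M p r ≡ true
      chosen  : selected v r p ≡ true
  open Corner

  corner-sound : ∀ {v p r} → corner v p r ≡ true → Corner v p r
  corner-sound {v} {p} {r} _ with M∖N v p in vp | N∖M v r in vr | M p r in pr | selected v r p in sel
  ... | true | true | true | true = record { spoke = vp ; base = vr ; closing = pr ; chosen = sel }

  corner-intro : ∀ {v p r} → M∖N v p ≡ true → N∖M v r ≡ true → M p r ≡ true → selected v r p ≡ true →
    corner v p r ≡ true
  corner-intro vp vr pr sel rewrite vp | vr | pr | sel = refl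

  tieBreak-complementary : ∀ {v r p} → v ≢ r → N v r ≡ true →
    tieBreak v r p (secondApex v r p) ≡ not (tieBreak r v p (secondApex r v p))
  tieBreak-complementary {v} {r} {p} v≢r vr rewrite sym (secondApex-sym v r p) with secondApex v r p in apex
  ... | nothing = <ᵇ-flip v≢r
  ... | just q with M∩N v q in vq | M∩N r q in rq
  ...   | true  | true  = ⊥-elim (N-tf v r q (vr , M∩N⇒N rq , N-swap (M∩N⇒N vq)))
  ...   | true  | false = refl
  ...   | false | true  = refl
  ...   | false | false rewrite <ᵇ-flip {i = r} (≢-sym v≢r) =
    sym (trans (cong (λ b → not (not b)) (sym (not-distribʳ-xor (p <ᵇ q) (v <ᵇ r))))
               (not-involutive _))

  both-selected⇒M∩N : ∀ {v u a b} → a ≢ b → M∩N v a ≡ false → M∩N v b ≡ false →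
    M∩N u a ∨ tieBreak v u a (just b) ≡ true → M∩N u b ∨ tieBreak v u b (just a) ≡ true →
    M∩N u a ≡ true × M∩N u b ≡ true
  both-selected⇒M∩N {v} {u} {a} {b} a≢b va vb sel-a sel-b rewrite va | vb with M∩N u a | M∩N u b
  ... | true  | true  = refl , refl
  ... | true  | false = ⊥-elim (true≢false (sym sel-b))
  ... | false | true  = ⊥-elim (true≢false (sym sel-a))
  ... | false | false rewrite <ᵇ-flip a≢b = ⊥-elim (xor-complement-conflict (b <ᵇ a) (v <ᵇ u) sel-b sel-a)

  corner-unique-M∖N : ∀ {v u a b} → corner v a u ≡ true → corner v b u ≡ true → a ≡ b
  corner-unique-M∖N {v} {u} {a} {b} va-u vb-u with a ≟ b
  ... | yes a≡b = a≡b
  ... | no a≢b with corner-sound va-u | corner-sound vb-u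
  ...   | record { spoke = va ; base = vu ; closing = au ; chosen = sel-a }
        | record { spoke = vb ; closing = bu ; chosen = sel-b } with both-selected⇒M∩N a≢b (M∖N⇒¬M∩N va) (M∖N⇒¬M∩N vb)
          (subst (λ m → M∩N u a ∨ tieBreak v u a m ≡ true) (secondApex-unique (M∖N⇒M va) (M∖N⇒M vb) (M-swap bu) a≢b) sel-a)
          (subst (λ m → M∩N u b ∨ tieBreak v u b m ≡ true) (secondApex-unique (M∖N⇒M vb) (M∖N⇒M va) (M-swap au) (≢-sym a≢b)) sel-b)
  ...     | ua , ub = ⊥-elim (M⇒≢ (M∖N⇒M vb) (sym (N-third (M∩N⇒N ua) (M∩N⇒N ub) (N-swap (N∖M⇒N vu)) a≢b
                          (≢-sym (M⇒≢ (M∖N⇒M va))))))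

  corner-unique-N∖M : ∀ {v u a b} → corner v u a ≡ true → corner v u b ≡ true → a ≡ b
  corner-unique-N∖M vu-a vu-b with corner-sound vu-a | corner-sound vu-b
  ... | a | b = M-third (M-swap (M∖N⇒M (spoke a))) (closing a) (closing b) (N⇒≢ (N∖M⇒N (base a))) (N⇒≢ (N∖M⇒N (base b)))

  paired-unique : ∀ {v u a b} → paired v u a ≡ true → paired v u b ≡ true → a ≡ b
  paired-unique {v} {u} {a} {b} ua ub with ∨-true {corner v u a} ua | ∨-true {corner v u b} ub
  ... | inj₁ x | inj₁ y = corner-unique-N∖M x y
  ... | inj₁ x | inj₂ y = ⊥-elim (M∖N-N∖M-disjoint (spoke (corner-sound x)) (base (corner-sound y)))
  ... | inj₂ x | inj₁ y = ⊥-elim (M∖N-N∖M-disjoint (spoke (corner-sound y)) (base (corner-sound x)))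
  ... | inj₂ x | inj₂ y = corner-unique-M∖N x y

  partner-sound : ∀ {v u w} → partner v u ≡ just w → Corner v u w ⊎ Corner v w u
  partner-sound {v} {u} found with ∨-true {corner v u _} (first-sound (paired v u) found)
  ... | inj₁ x = inj₁ (corner-sound x)
  ... | inj₂ x = inj₂ (corner-sound x)

  partner-complete : ∀ {v u w} → paired v u w ≡ true → partner v u ≡ just w
  partner-complete {v} {u} uw with first-complete (paired v u) uw
  ... | _ , found with paired-unique uw (first-sound (paired v u) found)
  ...   | refl = found

  partner-sym : ∀ {v u w} → partner v u ≡ just w → partner v w ≡ just u
  partner-sym {v} {u} {w} found =
    partner-complete (trans (∨-comm (corner v w u) (corner v u w)) (first-sound (paired v u) found))

  partner-functional : ∀ {v u w w′} → partner v u ≡ just w → partner v u ≡ just w′ → w ≡ w′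
  partner-functional found found′ = just-injective (trans (sym found) found′)

  partner-M : ∀ {v u w} → partner v u ≡ just w → M u w ≡ true
  partner-M found with partner-sound found
  ... | inj₁ x = closing x
  ... | inj₂ x = M-swap (closing x)

  partner-alternates : ∀ {v u w} → partner v u ≡ just w → M v u ≡ not (M v w)
  partner-alternates found with partner-sound found
  ... | inj₁ x rewrite M∖N⇒M (spoke x) | N∖M⇒¬M (base x) = refl
  ... | inj₂ x rewrite M∖N⇒M (spoke x) | N∖M⇒¬M (base x) = refl

  partner-⊕ : ∀ {v u w} → partner v u ≡ just w → (M ⊕ N) v u ≡ true
  partner-⊕ found with partner-sound found
  ... | inj₁ x = ⊕-intro (inj₁ (spoke x))
  ... | inj₂ x = ⊕-intro (inj₂ (base x))

  partner-one-end : ∀ {v u w} → partner v u ≡ just w → partner u v ≡ just w → ⊥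
  partner-one-end {v} {u} {w} at-v at-u with partner-sound at-v | partner-sound at-u
  ... | inj₁ x | inj₁ y = M-clash (closing x) (M-swap (N∖M⇒¬M (base y)))
  ... | inj₁ x | inj₂ y = M-clash (M∖N⇒M (spoke x)) (N∖M⇒¬M (base y))
  ... | inj₂ x | inj₁ y = M-clash (M∖N⇒M (spoke y)) (N∖M⇒¬M (base x))
  ... | inj₂ x | inj₂ y with chosen x | chosen y
  ...   | sel-v | sel-u
        rewrite M∖N⇒¬M∩N (spoke y) | M∖N⇒¬M∩N (spoke x)
              | tieBreak-complementary {v} {u} {w} (N⇒≢ (N∖M⇒N (base x))) (N∖M⇒N (base x)) | sel-u = true≢false (sym sel-v)

  corner-partner : ∀ {x y z} → N∖M x y ≡ true → M∖N x z ≡ true → M y z ≡ true → selected x y z ≡ true →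
    partner x y ≡ just z
  corner-partner {x} {y} {z} xy xz yz sel =
    partner-complete (∨-introʳ {corner x y z} (corner-intro xz xy (M-swap yz) sel))

  N-apex-open : ∀ {x y z} → N x y ≡ true → N x z ≡ false ⊎ N y z ≡ false
  N-apex-open {x} {y} {z} xy with true-or-false (N x z) | true-or-false (N y z)
  ... | inj₁ xz  | inj₁ yz  = ⊥-elim (N-tf x y z (xy , yz , N-swap xz))
  ... | inj₁ _   | inj₂ ¬yz = inj₂ ¬yz
  ... | inj₂ ¬xz | _        = inj₁ ¬xz

  triangle-paired : ∀ {x y z} → N x y ≡ true → M x y ≡ false → M x z ≡ true → M y z ≡ true →
    N x z ≡ false ⊎ N y z ≡ false → partner x y ≡ just z ⊎ partner y x ≡ just z
  triangle-paired {x} {y} {z} xy ¬xy xz yz ¬both with N x z in nxz | N y z in nyz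
  ... | true  | true  = ⊥-elim ([ true≢false , true≢false ]′ ¬both)
  ... | false | true  = inj₁ (corner-partner (N∖M-intro xy ¬xy) (M∖N-intro xz nxz) yz (∨-introˡ (M∩N-intro yz nyz)))
  ... | true  | false = inj₂ (corner-partner (N∖M-intro (N-swap xy) (M-swap ¬xy)) (M∖N-intro yz nyz) xz
                               (∨-introˡ (M∩N-intro xz nxz)))
  ... | false | false with true-or-false (tieBreak x y z (secondApex x y z))
  ...   | inj₁ x-wins  = inj₁ (corner-partner (N∖M-intro xy ¬xy) (M∖N-intro xz nxz) yz (∨-introʳ x-wins))
  ...   | inj₂ x-loses = inj₂ (corner-partner (N∖M-intro (N-swap xy) (M-swap ¬xy)) (M∖N-intro yz nyz) xz
                                 (∨-introʳ (trans (tieBreak-complementary (≢-sym (N⇒≢ xy)) (N-swap xy))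
                                                  (cong not x-loses))))

  partner⇒≢₁ : ∀ {v u w} → partner v u ≡ just w → v ≢ u
  partner⇒≢₁ found = ⊕⇒≢ (partner-⊕ found)

  partner⇒≢₂ : ∀ {v u w} → partner v u ≡ just w → v ≢ w
  partner⇒≢₂ found = ⊕⇒≢ (partner-⊕ (partner-sym found))

  partner⇒≢₃ : ∀ {v u w} → partner v u ≡ just w → u ≢ w
  partner⇒≢₃ found = M⇒≢ (partner-M found)

  -- p₂ is M-adjacent to p₀ and p₄ (closing edges of the outer corners) and, by alternation,
  -- to p₁ or p₃; a 2-matching leaves no room for p₄ ≠ p₀.
  partner-chain-closes : ∀ {p₀ p₁ p₂ p₃ p₄} → partner p₁ p₀ ≡ just p₂ → partner p₂ p₁ ≡ just p₃ →
    partner p₃ p₂ ≡ just p₄ → p₄ ≡ p₀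
  partner-chain-closes {p₀} {p₁} {p₂} {p₃} {p₄} at₁ at₂ at₃ with true-or-false (M p₂ p₁)
  ... | inj₁ m₂₁ with M-two p₂ p₀ p₄ p₁ (M-swap (partner-M at₁)) (partner-M at₃) m₂₁
  ...   | inj₁ p₀≡p₄        = sym p₀≡p₄
  ...   | inj₂ (inj₁ p₀≡p₁) = ⊥-elim (partner⇒≢₁ at₁ (sym p₀≡p₁))
  ...   | inj₂ (inj₂ refl)  = ⊥-elim (partner-one-end (partner-sym at₂) at₃)
  partner-chain-closes {p₀} {p₁} {p₂} {p₃} {p₄} at₁ at₂ at₃ | inj₂ ¬m₂₁
    with M-two p₂ p₀ p₄ p₃ (M-swap (partner-M at₁)) (partner-M at₃) (≡not-false⇒true (partner-alternates at₂) ¬m₂₁)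
  ...   | inj₁ p₀≡p₄        = sym p₀≡p₄
  ...   | inj₂ (inj₁ refl)  = ⊥-elim (partner-one-end (partner-sym at₁) at₂)
  ...   | inj₂ (inj₂ p₄≡p₃) = ⊥-elim (partner⇒≢₂ at₃ (sym p₄≡p₃))

  -- Alternation makes one of p₀p₁, p₀p₃ an N∖M edge of the triangle p₀ p₁ p₃ (closed by the
  -- M-edge p₁p₃); its far end already pairs it towards p₂, so the triangle is served at p₀.
  partner-4-cycle : ∀ {p₀ p₁ p₂ p₃} → partner p₁ p₀ ≡ just p₂ → partner p₂ p₁ ≡ just p₃ →
    partner p₃ p₂ ≡ just p₀ → partner p₀ p₃ ≡ just p₁
  partner-4-cycle {p₀} {p₁} {p₂} {p₃} at₁ at₂ at₃ with true-or-false (M p₀ p₁)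
  ... | inj₁ m₀₁ = at-p₀ (triangle-paired (⊕-¬M⇒N ⊕₀₃ ¬m₀₃) ¬m₀₃ m₀₁ (M-swap m₁₃) (inj₁ (⊕-M⇒¬N (⊕-swap (partner-⊕ at₁)) m₀₁)))
    where
    ⊕₀₃ = ⊕-swap (partner-⊕ (partner-sym at₃))
    m₁₃ = partner-M at₂
    ¬m₀₃ : M p₀ p₃ ≡ false
    ¬m₀₃ = M-swap (≡not-true⇒false (partner-alternates at₃)
             (M-swap (≡not-false⇒true (partner-alternates at₂) (M-swap (≡not-true⇒false (partner-alternates at₁) (M-swap m₀₁))))))
    at-p₀ : partner p₀ p₃ ≡ just p₁ ⊎ partner p₃ p₀ ≡ just p₁ → partner p₀ p₃ ≡ just p₁
    at-p₀ (inj₁ found) = found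
    at-p₀ (inj₂ found) = ⊥-elim (partner⇒≢₂ at₁ (sym (partner-functional (partner-sym at₃) found)))
  ... | inj₂ ¬m₀₁ = at-p₀ (triangle-paired (⊕-¬M⇒N (⊕-swap (partner-⊕ at₁)) ¬m₀₁) ¬m₀₁ m₀₃ m₁₃ (inj₁ (⊕-M⇒¬N ⊕₀₃ m₀₃)))
    where
    ⊕₀₃ = ⊕-swap (partner-⊕ (partner-sym at₃))
    m₁₃ = partner-M at₂
    m₀₃ : M p₀ p₃ ≡ true
    m₀₃ = M-swap (≡not-false⇒true (partner-alternates at₃)
            (M-swap (≡not-true⇒false (partner-alternates at₂) (M-swap (≡not-false⇒true (partner-alternates at₁) (M-swap ¬m₀₁))))))
    at-p₀ : partner p₀ p₁ ≡ just p₃ ⊎ partner p₁ p₀ ≡ just p₃ → partner p₀ p₃ ≡ just p₁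
    at-p₀ (inj₁ found) = partner-sym found
    at-p₀ (inj₂ found) = ⊥-elim (partner⇒≢₂ at₂ (partner-functional at₁ found))

  -- Pieces

  PartnerClosed : List V → Set
  PartnerClosed vs = ∀ {x y z} → (x , y) ∈ᴱ vs → partner y x ≡ just z → (y , z) ∈ᴱ vs

  Within⊕ : List V → Set
  Within⊕ vs = All (λ e → inSet (M ⊕ N) e ≡ true) (edges vs)

  ⊕-resp : ∀ {e f : Edge n} → SameEdge e f → inSet (M ⊕ N) f ≡ true → inSet (M ⊕ N) e ≡ true
  ⊕-resp (inj₁ (refl , refl)) f = f
  ⊕-resp (inj₂ (refl , refl)) f = ⊕-swap f

  module _ {k : Kind} {vs : List V} (closed : PartnerClosed vs)
           (consecutive : AdjacentEdgesConsecutive k vs) (within : Within⊕ vs) where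

    triangle-with-one-edge-on : ∀ {x y z} → adj G y z ≡ true → adj G z x ≡ true → (x , y) ∈ᴱ vs →
      M y z ≡ true → M z x ≡ true →
      ConsecutiveOn k vs (x , y) (y , z) ⊎ ConsecutiveOn k vs (z , x) (x , y)
    triangle-with-one-edge-on {x} {y} {z} yz zx xy∈ myz mzx with true-or-false (M x y)
    ... | inj₁ mxy  = ⊥-elim (M-tf x y z (mxy , myz , mzx))
    ... | inj₂ ¬mxy with triangle-paired nxy ¬mxy (M-swap mzx) myz (N-apex-open nxy)
      where nxy = ⊕-¬M⇒N (All-∈ᴱ ⊕-resp within xy∈) ¬mxy
    ...   | inj₁ at-x = inj₂ (consecutive (≢-sym (adj⇒≢ G yz)) (∈ᴱ-swap (closed (∈ᴱ-swap xy∈) at-x)) xy∈)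
    ...   | inj₂ at-y = inj₁ (consecutive (≢-sym (adj⇒≢ G zx)) xy∈ (closed xy∈ at-y))

    amenable : Amenable G M k vs
    amenable a b c ab bc ca (inj₂ ab∈) (inj₂ bc∈) _ = inj₁ (consecutive (≢-sym (adj⇒≢ G ca)) ab∈ bc∈)
    amenable a b c ab bc ca _ (inj₂ bc∈) (inj₂ ca∈) = inj₂ (inj₁ (consecutive (≢-sym (adj⇒≢ G ab)) bc∈ ca∈))
    amenable a b c ab bc ca (inj₂ ab∈) _ (inj₂ ca∈) = inj₂ (inj₂ (consecutive (≢-sym (adj⇒≢ G bc)) ca∈ ab∈))
    amenable a b c ab bc ca (inj₁ mab) (inj₁ mbc) (inj₁ mca) = ⊥-elim (M-tf a b c (mab , mbc , mca))
    amenable a b c ab bc ca (inj₂ ab∈) (inj₁ mbc) (inj₁ mca) with triangle-with-one-edge-on bc ca ab∈ mbc mca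
    ... | inj₁ r = inj₁ r
    ... | inj₂ r = inj₂ (inj₂ r)
    amenable a b c ab bc ca (inj₁ mab) (inj₂ bc∈) (inj₁ mca) with triangle-with-one-edge-on ca ab bc∈ mca mab
    ... | inj₁ r = inj₂ (inj₁ r)
    ... | inj₂ r = inj₁ r
    amenable a b c ab bc ca (inj₁ mab) (inj₁ mbc) (inj₂ ca∈) with triangle-with-one-edge-on ab bc ca∈ mab mbc
    ... | inj₁ r = inj₂ (inj₂ r)
    ... | inj₂ r = inj₂ (inj₁ r)

  data Step : Edge n → Edge n → Set where
    same : ∀ {e f} → SameEdge e f → Step e f
    turn : ∀ {e f x y z} → SameEdge e (x , y) → partner y x ≡ just z → SameEdge (y , z) f → Step e f

  Reach : Edge n → Edge n → Set
  Reach = Star Step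

  Step-sym : ∀ {e f} → Step e f → Step f e
  Step-sym (same s) = same (SameEdge-sym s)
  Step-sym (turn s found t) =
    turn (SameEdge-trans (SameEdge-sym t) SameEdge-swap) (partner-sym found) (SameEdge-trans SameEdge-swap (SameEdge-sym s))

  Reach-sym : ∀ {e f} → Reach e f → Reach f e
  Reach-sym = reverse Step-sym

  Reach-same : ∀ {e f} → SameEdge e f → Reach e f
  Reach-same s = same s ◅ ε

  Reach-turn : ∀ {x y z} → partner y x ≡ just z → Reach (x , y) (y , z)
  Reach-turn found = turn SameEdge-refl found SameEdge-refl ◅ ε

  reach-stays-on : ∀ {vs e f} → PartnerClosed vs → e ∈ᴱ vs → Reach e f → f ∈ᴱ vs
  reach-stays-on closed e∈ ε = e∈
  reach-stays-on closed e∈ (same s ◅ r) = reach-stays-on closed (∈ᴱ-resp (SameEdge-sym s) e∈) r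
  reach-stays-on closed e∈ (turn s found t ◅ r) =
    reach-stays-on closed (∈ᴱ-resp (SameEdge-sym t) (closed (∈ᴱ-resp (SameEdge-sym s) e∈) found)) r

  -- A walk along pairings; W is the whole piece, on which the pairing at the far end must land.
  data Chain (W : List V) : List V → Set where
    stop  : ∀ {a b} → (M ⊕ N) a b ≡ true → partner b a ≡ nothing → Chain W (a ∷ b ∷ [])
    close : ∀ {a b c} → partner b a ≡ just c → (b , c) ∈ᴱ W → Chain W (a ∷ b ∷ [])
    next  : ∀ {a b c vs} → partner b a ≡ just c → Chain W (b ∷ c ∷ vs) → Chain W (a ∷ b ∷ c ∷ vs)

  chain-within : ∀ {W vs} → Chain W vs → Within⊕ vs
  chain-within (stop ab _)      = ab ∷ []
  chain-within (close found _)  = ⊕-swap (partner-⊕ found) ∷ []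
  chain-within (next found ch) = ⊕-swap (partner-⊕ found) ∷ chain-within ch

  partner-Alt : ∀ {a b c} → partner b a ≡ just c → Alt M (a , b) (b , c)
  partner-Alt {a} {b} found = trans (proj₁ M⊆G a b) (partner-alternates found)

  chain-alternating : ∀ {W vs} → Chain W vs → Linked (Alt M) (edges vs)
  chain-alternating (stop _ _)    = [-]
  chain-alternating (close _ _)   = [-]
  chain-alternating (next found ch) = partner-Alt found ∷ chain-alternating ch

  chain-reach : ∀ {W a b vs} → Chain W (a ∷ b ∷ vs) → ∀ {f} → f ∈ᴱ (a ∷ b ∷ vs) → Reach (a , b) f
  chain-reach _               (here s)    = Reach-same (SameEdge-sym s)
  chain-reach (next found ch) (there f∈) = Reach-turn found ◅◅ chain-reach ch f∈

  chain-closed : ∀ {W a b vs} → Chain W (a ∷ b ∷ vs) → (∀ {e} → e ∈ᴱ (a ∷ b ∷ vs) → e ∈ᴱ W) →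
    (∀ {z} → partner a b ≡ just z → (a , z) ∈ᴱ W) →
    ∀ {x y z} → (x , y) ∈ᴱ (a ∷ b ∷ vs) → partner y x ≡ just z → (y , z) ∈ᴱ W
  chain-closed (stop _ none) _ _ (here (inj₁ (refl , refl))) found = ⊥-elim (just-nothing-clash found none)
  chain-closed (close at-b bc∈) _ _ (here (inj₁ (refl , refl))) found with partner-functional at-b found
  ... | refl = bc∈
  chain-closed _ _ start (here (inj₂ (refl , refl))) found = start found
  chain-closed (next at-b _) onW _ (here (inj₁ (refl , refl))) found with partner-functional at-b found
  ... | refl = onW (there (here SameEdge-refl))
  chain-closed (next at-b ch) onW _ (there xy∈) found = chain-closed ch (λ e∈ → onW (there e∈)) start xy∈ found
    where
    start : ∀ {z} → partner _ _ ≡ just z → (_ , z) ∈ᴱ _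
    start found′ with partner-functional (partner-sym at-b) found′
    ... | refl = onW (here SameEdge-swap)

  record Component (e : Edge n) (P : Piece n) : Set where
    field
      alternating : IsAltKind G M (proj₁ P) (proj₂ P)
      closed      : PartnerClosed (proj₂ P)
      consecutive : AdjacentEdgesConsecutive (proj₁ P) (proj₂ P)
      within      : Within⊕ (proj₂ P)
      reachable   : ∀ {f} → f ∈ᴱ proj₂ P → Reach e f
      contains    : e ∈ᴱ proj₂ P

  within⇒adj : ∀ {vs} → Within⊕ vs → All (λ e → inSet (adj G) e ≡ true) (edges vs)
  within⇒adj = All.map ⊕⇒adj

  path-component : ∀ {a b rest} → Chain (a ∷ b ∷ rest) (a ∷ b ∷ rest) → partner a b ≡ nothing →
    Unique (a ∷ b ∷ rest) → Component (a , b) (path , a ∷ b ∷ rest)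
  path-component {a} {b} {rest} ch start u = record
    { alternating = (_ , _ , refl) , within⇒adj (chain-within ch) , chain-alternating ch , edges-unique _ u
    ; closed      = chain-closed ch (λ e∈ → e∈) (λ found → ⊥-elim (just-nothing-clash found start))
    ; consecutive = consecutive-on-path _ u
    ; within      = chain-within ch
    ; reachable   = chain-reach ch
    ; contains    = here SameEdge-refl
    }

  cycle-component : ∀ {a b c d} → partner b a ≡ just c → partner c b ≡ just d → partner d c ≡ just a →
    partner a d ≡ just b → Unique (a ∷ b ∷ c ∷ d ∷ []) → Component (a , b) (cycle , a ∷ b ∷ c ∷ d ∷ a ∷ [])
  cycle-component {a} {b} {c} {d} at-b at-c at-d at-a u = record
    { alternating = ((_ , _ , refl) , within⇒adj {W} (chain-within ch) , chain-alternating ch , 4-cycle-edges-unique u)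
                  , refl , λ { _ _ refl refl → partner-Alt at-a }
    ; closed      = chain-closed ch (λ e∈ → e∈) start
    ; consecutive = consecutive-on-4-cycle u
    ; within      = chain-within ch
    ; reachable   = chain-reach ch
    ; contains    = here SameEdge-refl
    }
    where
    W = a ∷ b ∷ c ∷ d ∷ a ∷ []
    ch : Chain W W
    ch = next at-b (next at-c (next at-d (close at-a (here SameEdge-refl))))
    start : ∀ {z} → partner a b ≡ just z → (a , z) ∈ᴱ W
    start found with partner-functional (partner-sym at-a) found
    ... | refl = there (there (there (here SameEdge-swap)))

  ThreeCorners : V → V → Set
  ThreeCorners a b = ∃ λ c → ∃ λ d → ∃ λ z → partner b a ≡ just c × partner c b ≡ just d × partner d c ≡ just z

  data ForwardView (a b : V) : Set where
    stop₁ : partner b a ≡ nothing → ForwardView a b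
    stop₂ : ∀ {c} → partner b a ≡ just c → partner c b ≡ nothing → ForwardView a b
    stop₃ : ∀ {c d} → partner b a ≡ just c → partner c b ≡ just d → partner d c ≡ nothing → ForwardView a b
    loop  : ∀ {c d} → partner b a ≡ just c → partner c b ≡ just d → partner d c ≡ just a → ForwardView a b

  forward : ∀ a b → ForwardView a b
  forward a b with partner b a in at-b
  ... | nothing = stop₁ at-b
  ... | just c with partner c b in at-c
  ...   | nothing = stop₂ at-b at-c
  ...   | just d with partner d c in at-d
  ...     | nothing = stop₃ at-b at-c at-d
  ...     | just _  = loop at-b at-c (subst (λ z → partner d c ≡ just z) (partner-chain-closes at-b at-c at-d) at-d)

  forwardPiece : ∀ {a b} → ForwardView a b → Piece n
  forwardPiece {a} {b} (stop₁ _)                 = path , a ∷ b ∷ []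
  forwardPiece {a} {b} (stop₂ {c} _ _)           = path , a ∷ b ∷ c ∷ []
  forwardPiece {a} {b} (stop₃ {c} {d} _ _ _)     = path , a ∷ b ∷ c ∷ d ∷ []
  forwardPiece {a} {b} (loop {c} {d} _ _ _)      = cycle , a ∷ b ∷ c ∷ d ∷ a ∷ []

  one-corner-unique : ∀ {a b c} → partner b a ≡ just c → Unique (a ∷ b ∷ c ∷ [])
  one-corner-unique at-b = (≢-sym (partner⇒≢₁ at-b) ∷ partner⇒≢₃ at-b ∷ []) ∷ (partner⇒≢₂ at-b ∷ []) ∷ [] ∷ []

  two-corners-unique : ∀ {a b c d} → partner b a ≡ just c → partner c b ≡ just d → Unique (a ∷ b ∷ c ∷ d ∷ [])
  two-corners-unique {a} {d = d} at-b at-c with one-corner-unique at-b | one-corner-unique at-c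
  ... | (a≢b ∷ a≢c ∷ []) ∷ _ | (b≢c ∷ b≢d ∷ []) ∷ (c≢d ∷ []) ∷ _ =
    (a≢b ∷ a≢c ∷ a≢d ∷ []) ∷ (b≢c ∷ b≢d ∷ []) ∷ (c≢d ∷ []) ∷ [] ∷ []
    where
    a≢d : a ≢ d
    a≢d refl = partner-one-end (partner-sym at-b) at-c

  forward-component : ∀ {a b} (view : ForwardView a b) → (M ⊕ N) a b ≡ true →
    partner a b ≡ nothing ⊎ ThreeCorners a b → Component (a , b) (forwardPiece view)
  forward-component (stop₁ none) ab (inj₁ start) =
    path-component (stop ab none) start ((⊕⇒≢ ab ∷ []) ∷ [] ∷ [])
  forward-component (stop₂ at-b none) ab (inj₁ start) =
    path-component (next at-b (stop (partner-⊕ (partner-sym at-b)) none)) start (one-corner-unique at-b)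
  forward-component (stop₃ at-b at-c none) ab (inj₁ start) =
    path-component (next at-b (next at-c (stop (partner-⊕ (partner-sym at-c)) none))) start
      (two-corners-unique at-b at-c)
  forward-component (loop at-b at-c at-d) _ _ =
    cycle-component at-b at-c at-d (partner-4-cycle at-b at-c at-d)
      (two-corners-unique at-b at-c)
  forward-component (stop₁ none) _ (inj₂ (_ , _ , _ , at-b , _)) = ⊥-elim (just-nothing-clash at-b none)
  forward-component (stop₂ at-b none) _ (inj₂ (_ , _ , _ , at-b′ , at-c , _)) with partner-functional at-b at-b′
  ... | refl = ⊥-elim (just-nothing-clash at-c none)
  forward-component (stop₃ at-b at-c none) _ (inj₂ (_ , _ , _ , at-b′ , at-c′ , at-d)) with partner-functional at-b at-b′
  ... | refl with partner-functional at-c at-c′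
  ...   | refl = ⊥-elim (just-nothing-clash at-d none)

  Component-from : ∀ {e e′ P} → Reach e e′ → Component e′ P → Component e P
  Component-from e→e′ c = record
    { alternating = alternating ; closed = closed ; consecutive = consecutive ; within = within
    ; reachable   = λ f∈ → e→e′ ◅◅ reachable f∈
    ; contains    = reach-stays-on closed contains (Reach-sym e→e′)
    }
    where open Component c

  Reach-back : ∀ {u v t} → partner u v ≡ just t → Reach (u , v) (t , u)
  Reach-back found = turn SameEdge-swap found SameEdge-swap ◅ ε

  data BackwardView (u v : V) : Set where
    origin : partner u v ≡ nothing → BackwardView u v
    back₁  : ∀ {t} → partner u v ≡ just t → partner t u ≡ nothing → BackwardView u v
    back₂  : ∀ {t s} → partner u v ≡ just t → partner t u ≡ just s → partner s t ≡ nothing → BackwardView u v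
    back₃  : ∀ {t s r} → partner u v ≡ just t → partner t u ≡ just s → partner s t ≡ just r → BackwardView u v

  backward : ∀ u v → BackwardView u v
  backward u v with partner u v in at-u
  ... | nothing = origin at-u
  ... | just t with partner t u in at-t
  ...   | nothing = back₁ at-u at-t
  ...   | just s with partner s t in at-s
  ...     | nothing = back₂ at-u at-t at-s
  ...     | just _  = back₃ at-u at-t at-s

  start : ∀ {u v} → BackwardView u v → Edge n
  start {u} {v} (origin _)            = u , v
  start {u} (back₁ {t} _ _)           = t , u
  start (back₂ {t} {s} _ _ _)         = s , t
  start (back₃ {t} {s} _ _ _)         = s , t

  -- Three backward corners from u v lie on a 4-cycle, so walking forward from the start
  -- goes round that cycle.
  start-ok : ∀ {u v} (view : BackwardView u v) → (M ⊕ N) u v ≡ true →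
    let (s , t) = start view in
    (M ⊕ N) s t ≡ true × (partner s t ≡ nothing ⊎ ThreeCorners s t) × Reach (u , v) (s , t)
  start-ok (origin none) uv = uv , inj₁ none , ε
  start-ok (back₁ at-u none) _ = ⊕-swap (partner-⊕ (partner-sym at-u)) , inj₁ none , Reach-back at-u
  start-ok (back₂ at-u at-t none) _ =
    ⊕-swap (partner-⊕ (partner-sym at-t)) , inj₁ none , Reach-back at-u ◅◅ Reach-back at-t
  start-ok {u} {v} (back₃ {t} {s} at-u at-t at-s) _ =
    ⊕-swap (partner-⊕ (partner-sym at-t)) , inj₂ (u , v , s , partner-sym at-t , partner-sym at-u , at-v) ,
    Reach-back at-u ◅◅ Reach-back at-t
    where
    at-v : partner v u ≡ just s
    at-v with partner-chain-closes (partner-sym at-s) (partner-sym at-t) (partner-sym at-u)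
    ... | refl = partner-4-cycle (partner-sym at-s) (partner-sym at-t) (partner-sym at-u)

  pieceOf : Edge n → Piece n
  pieceOf (u , v) = forwardPiece (forward (proj₁ (start (backward u v))) (proj₂ (start (backward u v))))

  pieceOf-component : ∀ {u v} → (M ⊕ N) u v ≡ true → Component (u , v) (pieceOf (u , v))
  pieceOf-component {u} {v} uv with start-ok (backward u v) uv
  ... | st , ends , u→s = Component-from u→s (forward-component (forward _ _) st ends)

  -- One representative per piece

  open import Data.List.Extrema (DecTotalOrder.totalOrder (edgeOrder {n})) using (argmin; f[argmin]≤f[xs]; argmin-all)

  IsKey : Edge n → Set
  IsKey (u , v) = u < v × (M ⊕ N) u v ≡ true

  Minimal : Edge n → Set
  Minimal e = All (λ f → e ≤ᴱ normal f) (edges (proj₂ (pieceOf e)))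

  IsRepresentative : Edge n → Set
  IsRepresentative e = IsKey e × Minimal e

  representative? : ∀ e → Dec (IsRepresentative e)
  representative? e@(u , v) =
    (u <? v ×-dec (M ⊕ N) u v ≟ᵇ true) ×-dec All.all? (λ f → e ≤ᴱ? normal f) _

  representatives : List (Edge n)
  representatives = filter representative? (cartesianProduct (allFin n) (allFin n))

  pieces : List (Piece n)
  pieces = map pieceOf representatives

  key-normal : ∀ {e} → IsKey e → normal e ≡ e
  key-normal (u<v , _) = normal-of-< u<v

  key-component : ∀ {e} → IsKey e → Component e (pieceOf e)
  key-component (_ , uv) = pieceOf-component uv

  minimal-below : ∀ {e f : Edge n} {vs} → All (λ g → e ≤ᴱ normal g) (edges vs) → f ∈ᴱ vs → e ≤ᴱ normal f
  minimal-below {e} = All-∈ᴱ (λ s → subst (e ≤ᴱ_) (sym (normal-resp s)))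

  representatives-agree : ∀ {e₁ e₂ a b} → IsRepresentative e₁ → IsRepresentative e₂ →
    a ∈ᴱ proj₂ (pieceOf e₁) → b ∈ᴱ proj₂ (pieceOf e₂) → SameEdge a b → e₁ ≡ e₂
  representatives-agree {e₁} {e₂} (key₁ , min₁) (key₂ , min₂) a∈ b∈ a≈b =
    ≡×≡⇒≡ (≤ᴱ-antisym (below min₁ key₂ c₁ e₁→e₂) (below min₂ key₁ c₂ (Reach-sym e₁→e₂)))
    where
    c₁ = key-component key₁
    c₂ = key-component key₂
    e₁→e₂ : Reach e₁ e₂
    e₁→e₂ = Component.reachable c₁ a∈ ◅◅ Reach-same a≈b ◅◅ Reach-sym (Component.reachable c₂ b∈)
    below : ∀ {e e′} → Minimal e → IsKey e′ → Component e (pieceOf e) → Reach e e′ → e ≤ᴱ e′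
    below {e} min key′ c e→e′ = subst (e ≤ᴱ_) (key-normal key′)
      (minimal-below min (reach-stays-on (Component.closed c) (Component.contains c) e→e′))

  representative-of : ∀ {e} → e ∈ representatives → IsRepresentative e
  representative-of e∈ = proj₂ (∈-filter⁻ representative? {xs = cartesianProduct (allFin n) (allFin n)} e∈)

  representatives-unique : Unique representatives
  representatives-unique = AllPairs.filter⁺ representative? (cartesianProduct⁺ (allFin⁺ n) (allFin⁺ n))

  piece-component : ∀ {e} → e ∈ representatives → Component e (pieceOf e)
  piece-component e∈ = key-component (proj₁ (representative-of e∈))

  IsAltKind-edges-distinct : ∀ k vs → IsAltKind G M k vs → AllPairs (λ e f → ¬ SameEdge e f) (edges vs)
  IsAltKind-edges-distinct path  _ (_ , _ , _ , distinct)       = distinct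
  IsAltKind-edges-distinct cycle _ ((_ , _ , _ , distinct) , _) = distinct

  pieces-good : All (GoodPiece G M) pieces
  pieces-good = All.map⁺ (All.tabulate λ {e} e∈ → let open Component (piece-component e∈) in
    alternating , amenable {proj₁ (pieceOf e)} closed consecutive within)

  pieces-within⊕ : All (λ e → inSet (M ⊕ N) e ≡ true) (concatMap pieceEdges pieces)
  pieces-within⊕ = All.concat⁺ (All.map⁺ (All.map⁺ (All.tabulate λ e∈ → Component.within (piece-component e∈))))

  pieces-disjoint : AllPairs (λ e f → ¬ SameEdge e f) (concatMap pieceEdges pieces)
  pieces-disjoint = AllPairs.concat⁺
    (All.map⁺ (All.map⁺ (All.tabulate λ e∈ →
      IsAltKind-edges-distinct _ _ (Component.alternating (piece-component e∈)))))
    (AllPairs.map⁺ (AllPairs.map⁺ (AllPairs-combine apart (All.tabulate representative-of) representatives-unique)))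
    where
    apart : ∀ {e₁ e₂} → IsRepresentative e₁ → IsRepresentative e₂ → e₁ ≢ e₂ →
      All (λ a → All (λ b → ¬ SameEdge a b) (pieceEdges (pieceOf e₂))) (pieceEdges (pieceOf e₁))
    apart r₁ r₂ e₁≢e₂ = All.tabulate λ a∈ → All.tabulate λ b∈ a≈b →
      e₁≢e₂ (representatives-agree r₁ r₂ (∈⇒∈ᴱ a∈) (∈⇒∈ᴱ b∈) a≈b)

  -- The representative of the piece through u v is the least normalised edge m of that piece;
  -- pieces through m and through u v have the same edges, so m is minimal on its own piece.
  pieces-cover : ∀ u v → (M ⊕ N) u v ≡ true → Any (SameEdge (u , v)) (concatMap pieceEdges pieces)
  pieces-cover u v uv =
    Any.concat⁺ (Any.map⁺ (Any.map⁺ (Any.map (λ { refl → uv∈ }) m∈representatives)))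
    where
    e₀ = normal (u , v)
    key₀ : IsKey e₀
    key₀ = normal-< u v (⊕⇒≢ uv) , ⊕-resp (SameEdge-sym (normal-SameEdge (u , v))) uv
    c₀ = key-component key₀
    vs₀ = proj₂ (pieceOf e₀)
    m′ = argmin normal e₀ (edges vs₀)
    m = normal m′
    m′∈ : m′ ∈ᴱ vs₀
    m′∈ = argmin-all normal {xs = edges vs₀} {P = _∈ᴱ vs₀} (Component.contains c₀) (All.tabulate ∈⇒∈ᴱ)
    e₀→m : Reach e₀ m
    e₀→m = Component.reachable c₀ m′∈ ◅◅ Reach-same (normal-SameEdge m′)
    ⊕m : (M ⊕ N) (proj₁ m) (proj₂ m) ≡ true
    ⊕m = ⊕-resp (SameEdge-sym (normal-SameEdge m′)) (All-∈ᴱ ⊕-resp (Component.within c₀) m′∈)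
    keyₘ : IsKey m
    keyₘ = normal-< _ _ (⊕⇒≢ (All-∈ᴱ ⊕-resp (Component.within c₀) m′∈)) , ⊕m
    cₘ = key-component keyₘ
    minₘ : Minimal m
    minₘ = All.tabulate λ f∈ → minimal-below (f[argmin]≤f[xs] e₀ (edges vs₀))
      (reach-stays-on (Component.closed c₀) (Component.contains c₀) (e₀→m ◅◅ Component.reachable cₘ (∈⇒∈ᴱ f∈)))
    m∈representatives : m ∈ representatives
    m∈representatives = ∈-filter⁺ representative? (∈-cartesianProduct⁺ (∈-allFin _) (∈-allFin _)) (keyₘ , minₘ)
    uv∈ : Any (SameEdge (u , v)) (pieceEdges (pieceOf m))
    uv∈ = reach-stays-on (Component.closed cₘ) (Component.contains cₘ)
      (Reach-sym e₀→m ◅◅ Reach-same (SameEdge-sym (normal-SameEdge (u , v))))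

theorem1 : (n : ℕ) (G : Graph n) (M N : EdgeSet n) →
    IsEdgeSetOf G M → IsEdgeSetOf G N →
    IsTwoMatching M → IsTwoMatching N →
    TriangleFree M → TriangleFree N →
    Σ (List (Piece n)) (IsAmenableDecomposition G M N)
theorem1 n G M N M⊆G N⊆G M-two N-two M-tf N-tf =
  pieces , pieces-good , pieces-within⊕ , pieces-disjoint , pieces-cover
  where open Decomposition G M N M⊆G N⊆G M-two N-two M-tf N-tf
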